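{- Let $C\subseteq 2^\omega$ be comeager. Then there is a continuous map $f=(f_0,f_1)\colon 2^\omega\to 2^\omega\times 2^\omega$ such that for all $x\in 2^\omega$: $f_0(x)\in C$, $f_1(x)\in C$, and $f_0(x)\,\Delta\, f_1(x)=x$.
   Context: For $x,y\in2^\omega$, $x\,\Delta\,y$ is the sequence $z\in 2^\omega$ with $z(n)=0$ if $x(n)=y(n)$ and $z(n)=1$ otherwise. -}

module Defs where

open import Data.Bool using (Bool; _xor_)
open import Data.Nat using (ℕ; zero; suc; _<_)
open import Data.List using (List; []; _∷_; _++_)
open import Data.Product using (Σ; ∃; _×_; proj₁; proj₂)
open import Relation.Binary.PropositionalEquality using (_≡_)

Cantor : Set
Cantor = ℕ → Bool

prefix : Cantor → ℕ → List Bool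
prefix x zero = []
prefix x (suc k) = x zero ∷ prefix (λ i → x (suc i)) k

Agree : ℕ → Cantor → Cantor → Set
Agree n x y = ∀ i → i < n → x i ≡ y i

_Δ_ : Cantor → Cantor → Cantor
(x Δ y) n = x n xor y n

-- An open set of 2^ω is coded by a set W of finite strings:
-- U_W = ⋃_{s ∈ W} [s] = { x | ∃ k, x↾k ∈ W }
InOpen : (List Bool → Set) → Cantor → Set
InOpen W x = ∃ λ k → W (prefix x k)

-- U_W is dense: every basic open [s] meets U_W, i.e. some extension of s lies in W
DenseCode : (List Bool → Set) → Set
DenseCode W = ∀ s → ∃ λ t → W (s ++ t)

Comeager : (Cantor → Set) → Set₁
Comeager C = Σ (ℕ → List Bool → Set) λ W →
  ((n : ℕ) → DenseCode (W n)) × (∀ x → (∀ n → InOpen (W n) x) → C x)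

Continuous₂ : (Cantor → Cantor × Cantor) → Set
Continuous₂ f = ∀ x n → ∃ λ m → ∀ y → Agree m x y →
  Agree n (proj₁ (f x)) (proj₁ (f y)) × Agree n (proj₂ (f x)) (proj₂ (f y))

-- Build f₀ x as the limit of finite approximations, and put f₁ x := f₀ x Δ x,
-- so the Δ-condition holds by construction. At stage k the current
-- approximation a is first extended so that f₀ x enters the k-th dense open
-- set; then, since f₁ x is determined on a finite prefix by f₀ x and x, it is
-- extended once more by the Δ-translate under x of an extension of the
-- corresponding prefix of f₁ x into the same dense open set. Both outputs meet
-- every dense open set, hence lie in C, and stage k reads only as many bits of
-- x as its length, which gives continuity.
module Submission where

open import Defs
open import Data.Bool using (Bool; false; _xor_)
open import Data.Bool.Properties using (xor-assoc; xor-same; xor-identityʳ)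
open import Data.List using (List; []; _∷_; _++_; _∷ʳ_; length)
open import Data.List.Properties using (length-++; ++-assoc; ++-identityʳ)
open import Data.Nat using (ℕ; zero; suc; _+_; _≤_; _<_; _≤′_; ≤′-refl; ≤′-step; z≤n; s≤s)
open import Data.Nat.Properties
  using (≤-trans; ≤-total; <-≤-trans; m≤m+n; m<m+n; +-monoʳ-<; ≤⇒≤′)
open import Data.Product using (Σ; ∃; _×_; _,_; proj₁; proj₂)
open import Data.Sum using (inj₁; inj₂)
open import Relation.Binary.PropositionalEquality
  using (_≡_; refl; sym; trans; cong; cong₂; subst; module ≡-Reasoning)
open ≡-Reasoning

xor-cancelʳ : ∀ a b → (a xor b) xor b ≡ a
xor-cancelʳ a b = begin
  (a xor b) xor b ≡⟨ xor-assoc a b b ⟩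
  a xor (b xor b) ≡⟨ cong (a xor_) (xor-same b) ⟩
  a xor false     ≡⟨ xor-identityʳ a ⟩
  a               ∎

xor-cancelˡ : ∀ a b → a xor (a xor b) ≡ b
xor-cancelˡ a b = begin
  a xor (a xor b) ≡⟨ sym (xor-assoc a a b) ⟩
  (a xor a) xor b ≡⟨ cong (_xor b) (xor-same a) ⟩
  b               ∎

_⊑_ : List Bool → List Bool → Set
s ⊑ t = ∃ λ r → s ++ r ≡ t

⊑-refl : ∀ s → s ⊑ s
⊑-refl s = [] , ++-identityʳ s

⊑-++ : ∀ s r → s ⊑ (s ++ r)
⊑-++ s r = r , refl

⊑-trans : ∀ {s t u} → s ⊑ t → t ⊑ u → s ⊑ u
⊑-trans {s} (r , refl) (r′ , refl) = r ++ r′ , sym (++-assoc s r r′)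

⊑-length : ∀ {s t} → s ⊑ t → length s ≤ length t
⊑-length {s} (r , refl) = subst (length s ≤_) (sym (length-++ s)) (m≤m+n _ _)

length-<-∷ʳ : ∀ (s : List Bool) b → length s < length (s ∷ʳ b)
length-<-∷ʳ s b = subst (length s <_) (sym (length-++ s)) (m<m+n (length s) {1} (s≤s z≤n))

-- Reading a string past its end gives the junk value false.
at : List Bool → ℕ → Bool
at []      i       = false
at (c ∷ s) zero    = c
at (c ∷ s) (suc i) = at s i

at-++ : ∀ s r {i} → i < length s → at s i ≡ at (s ++ r) i
at-++ (c ∷ s) r {zero}  _         = refl
at-++ (c ∷ s) r {suc i} (s≤s i<s) = at-++ s r i<s

at-⊑ : ∀ {s t i} → s ⊑ t → i < length s → at s i ≡ at t i
at-⊑ {s} (r , refl) = at-++ s r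

tail : Cantor → Cantor
tail x i = x (suc i)

shift : ℕ → Cantor → Cantor
shift m x i = x (m + i)

prefix-at : ∀ s (z : Cantor) → (∀ i → i < length s → z i ≡ at s i) →
            prefix z (length s) ≡ s
prefix-at []      z z≡s = refl
prefix-at (c ∷ s) z z≡s =
  cong₂ _∷_ (z≡s 0 (s≤s z≤n)) (prefix-at s (tail z) (λ i i<s → z≡s (suc i) (s≤s i<s)))

Agree-mono : ∀ {m n x y} → m ≤ n → Agree n x y → Agree m x y
Agree-mono m≤n x≈y i i<m = x≈y i (<-≤-trans i<m m≤n)

Agree-tail : ∀ {n x y} → Agree (suc n) x y → Agree n (tail x) (tail y)
Agree-tail x≈y i i<n = x≈y (suc i) (s≤s i<n)

Agree-shift : ∀ m {n x y} → Agree (m + n) x y → Agree n (shift m x) (shift m y)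
Agree-shift m x≈y i i<n = x≈y (m + i) (+-monoʳ-< m i<n)

_⊕_ : List Bool → Cantor → List Bool
[]      ⊕ z = []
(c ∷ s) ⊕ z = (c xor z 0) ∷ (s ⊕ tail z)

length-⊕ : ∀ s z → length (s ⊕ z) ≡ length s
length-⊕ []      z = refl
length-⊕ (c ∷ s) z = cong suc (length-⊕ s (tail z))

⊕-++ : ∀ s r z → (s ++ r) ⊕ z ≡ (s ⊕ z) ++ (r ⊕ shift (length s) z)
⊕-++ []      r z = refl
⊕-++ (c ∷ s) r z = cong (_ ∷_) (⊕-++ s r (tail z))

⊕-involutive : ∀ s z → (s ⊕ z) ⊕ z ≡ s
⊕-involutive []      z = refl
⊕-involutive (c ∷ s) z = cong₂ _∷_ (xor-cancelʳ c (z 0)) (⊕-involutive s (tail z))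

⊕-local : ∀ s {x y} → Agree (length s) x y → s ⊕ x ≡ s ⊕ y
⊕-local []      x≈y = refl
⊕-local (c ∷ s) x≈y = cong₂ _∷_ (cong (c xor_) (x≈y 0 (s≤s z≤n))) (⊕-local s (Agree-tail x≈y))

prefix-Δ : ∀ x z n → prefix (x Δ z) n ≡ prefix x n ⊕ z
prefix-Δ x z zero    = refl
prefix-Δ x z (suc n) = cong (_ ∷_) (prefix-Δ (tail x) (tail z) n)

module ChainLimit (a : ℕ → List Bool)
                  (extends : ∀ k → a k ⊑ a (suc k))
                  (grows : ∀ k → length (a k) < length (a (suc k))) where

  ⊑-chain : ∀ {j k} → j ≤ k → a j ⊑ a k
  ⊑-chain j≤k = go (≤⇒≤′ j≤k)
    where
    go : ∀ {j k} → j ≤′ k → a j ⊑ a k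
    go ≤′-refl          = ⊑-refl _
    go (≤′-step {k} j≤k) = ⊑-trans (go j≤k) (extends k)

  length-≥ : ∀ k → k ≤ length (a k)
  length-≥ zero    = z≤n
  length-≥ (suc k) = ≤-trans (s≤s (length-≥ k)) (grows k)

  limit : Cantor
  limit i = at (a (suc i)) i

  limit-at : ∀ {k i} → i < length (a k) → limit i ≡ at (a k) i
  limit-at {k} {i} i<a with ≤-total k (suc i)
  ... | inj₁ k≤1+i = sym (at-⊑ (⊑-chain k≤1+i) i<a)
  ... | inj₂ 1+i≤k = at-⊑ (⊑-chain 1+i≤k) (length-≥ (suc i))

  prefix-limit : ∀ {s k} → s ⊑ a k → prefix limit (length s) ≡ s
  prefix-limit {s} s⊑a = prefix-at s limit λ i i<s →
    trans (limit-at (<-≤-trans i<s (⊑-length s⊑a))) (sym (at-⊑ s⊑a i<s))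

module Construction (W : ℕ → List Bool → Set) (dense : ∀ n → DenseCode (W n)) where

  extension : ℕ → List Bool → List Bool
  extension n s = proj₁ (dense n s)

  enter₀ : ℕ → List Bool → List Bool
  enter₀ k a = a ++ extension k a

  -- The string that, appended after enter₀ k a, makes the f₁-prefix enter W k.
  enter₁ : ℕ → Cantor → List Bool → List Bool
  enter₁ k x a = extension k (enter₀ k a ⊕ x) ⊕ shift (length (enter₀ k a)) x

  -- The trailing bit only serves to make the approximations grow strictly.
  step : ℕ → Cantor → List Bool → List Bool
  step k x a = (enter₀ k a ++ enter₁ k x a) ∷ʳ false

  approx : Cantor → ℕ → List Bool
  approx x zero    = []
  approx x (suc k) = step k x (approx x k)

  ⊑-entered : ∀ k x a → a ⊑ (enter₀ k a ++ enter₁ k x a)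
  ⊑-entered k x a = ⊑-trans (⊑-++ a _) (⊑-++ (enter₀ k a) (enter₁ k x a))

  extends : ∀ x k → approx x k ⊑ approx x (suc k)
  extends x k = ⊑-trans (⊑-entered k x (approx x k)) (⊑-++ _ (false ∷ []))

  grows : ∀ x k → length (approx x k) < length (approx x (suc k))
  grows x k = <-≤-trans (s≤s (⊑-length (⊑-entered k x a)))
                        (length-<-∷ʳ (enter₀ k a ++ enter₁ k x a) false)
    where a = approx x k

  f₀ : Cantor → Cantor
  f₀ x = ChainLimit.limit (approx x) (extends x) (grows x)

  f₁ : Cantor → Cantor
  f₁ x = f₀ x Δ x

  prefix-f₀ : ∀ x {s k} → s ⊑ approx x k → prefix (f₀ x) (length s) ≡ s
  prefix-f₀ x {s} {k} = ChainLimit.prefix-limit (approx x) (extends x) (grows x) {s} {k}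

  f₀-in : ∀ x n → InOpen (W n) (f₀ x)
  f₀-in x n = length (enter₀ n a) ,
    subst (W n) (sym (prefix-f₀ x {k = suc n} (⊑-trans (⊑-++ _ _) (⊑-++ _ _))))
          (proj₂ (dense n a))
    where a = approx x n

  f₁-in : ∀ x n → InOpen (W n) (f₁ x)
  f₁-in x n = length (e₀ ++ enter₁ n x a) , subst (W n) (sym f₁-prefix) (proj₂ (dense n b))
    where
    a  = approx x n
    e₀ = enter₀ n a
    b  = e₀ ⊕ x
    f₁-prefix : prefix (f₁ x) (length (e₀ ++ enter₁ n x a)) ≡ b ++ extension n b
    f₁-prefix = begin
      prefix (f₀ x Δ x) (length (e₀ ++ enter₁ n x a))
        ≡⟨ prefix-Δ (f₀ x) x _ ⟩
      prefix (f₀ x) (length (e₀ ++ enter₁ n x a)) ⊕ x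
        ≡⟨ cong (_⊕ x) (prefix-f₀ x {k = suc n} (⊑-++ _ _)) ⟩
      (e₀ ++ enter₁ n x a) ⊕ x
        ≡⟨ ⊕-++ e₀ (enter₁ n x a) x ⟩
      b ++ enter₁ n x a ⊕ shift (length e₀) x
        ≡⟨ cong (b ++_) (⊕-involutive (extension n b) (shift (length e₀) x)) ⟩
      b ++ extension n b
        ∎

  step-local : ∀ k a {x y} → Agree (length (step k x a)) x y → step k x a ≡ step k y a
  step-local k a {x} {y} x≈y = cong (λ t → (e₀ ++ t) ∷ʳ false) enter₁-local
    where
    e₀ = enter₀ k a
    t  = extension k (e₀ ⊕ x)
    bound : length e₀ + length t ≤ length (step k x a)
    bound = subst (_≤ length (step k x a))
                  (trans (length-++ e₀) (cong (length e₀ +_) (length-⊕ t _)))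
                  (⊑-length (⊑-++ (e₀ ++ enter₁ k x a) _))
    x≈y′ : Agree (length e₀ + length t) x y
    x≈y′ = Agree-mono bound x≈y
    enter₁-local : enter₁ k x a ≡ enter₁ k y a
    enter₁-local = begin
      t ⊕ shift (length e₀) x
        ≡⟨ ⊕-local t (Agree-shift (length e₀) x≈y′) ⟩
      t ⊕ shift (length e₀) y
        ≡⟨ cong (λ b → extension k b ⊕ shift (length e₀) y)
                (⊕-local e₀ (Agree-mono (m≤m+n _ _) x≈y′)) ⟩
      enter₁ k y a
        ∎

  approx-local : ∀ k {x y} → Agree (length (approx x k)) x y → approx x k ≡ approx y k
  approx-local zero    x≈y = refl
  approx-local (suc k) {x} {y} x≈y = begin
    step k x (approx x k) ≡⟨ step-local k (approx x k) x≈y ⟩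
    step k y (approx x k) ≡⟨ cong (step k y) (approx-local k (Agree-mono (⊑-length (extends x k)) x≈y)) ⟩
    step k y (approx y k) ∎

  f₀-continuous : ∀ x n {y} → Agree (length (approx x n)) x y → Agree n (f₀ x) (f₀ y)
  f₀-continuous x n x≈y i i<n =
    cong (λ s → at s i) (approx-local (suc i) (Agree-mono (⊑-length (⊑-chain i<n)) x≈y))
    where open ChainLimit (approx x) (extends x) (grows x)

  continuous : Continuous₂ (λ x → f₀ x , f₁ x)
  continuous x n = length (approx x n) , λ y x≈y →
    f₀-continuous x n x≈y ,
    λ i i<n → cong₂ _xor_ (f₀-continuous x n x≈y i i<n) (x≈y i (<-≤-trans i<n (length-≥ n)))
    where open ChainLimit (approx x) (extends x) (grows x)

lemma3p8 : (C : Cantor → Set) → Comeager C →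
    Σ (Cantor → Cantor × Cantor) λ f → Continuous₂ f ×
      (∀ x → C (proj₁ (f x)) × C (proj₂ (f x)) × (∀ n → (proj₁ (f x) Δ proj₂ (f x)) n ≡ x n))
lemma3p8 C (W , dense , ⋂W⊆C) = (λ x → f₀ x , f₁ x) , continuous ,
  λ x → ⋂W⊆C (f₀ x) (f₀-in x) , ⋂W⊆C (f₁ x) (f₁-in x) , λ n → xor-cancelˡ (f₀ x n) (x n)
  where open Construction W dense
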